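{- Let $h\colon Q\to R$ be a homomorphism of unital quantales and $M$ a left $Q$-module. Regard $R$ as a right $Q$-module via $r\cdot a=r\,h(a)$. If there exist a left $R$-module $N$ and an injective $Q$-module morphism $f\colon M\to N_h$, then the $Q$-module homomorphism $\mu\colon M\to R\otimes_Q M$, $x\mapsto 1\otimes x$, is injective.
   Context: A (unital) quantale is a complete lattice with a monoid structure whose multiplication distributes over arbitrary joins on both sides; quantale homomorphisms preserve arbitrary joins, multiplication and unit. A left $Q$-module is a complete lattice $M$ with an action $Q\times M\to M$ satisfying $(ab)x=a(bx)$, $1x=x$ and distributing over arbitrary joins in each argument; right modules are symmetric; module morphisms are join-preserving action-preserving maps. For an $R$-module $N$, $N_h$ is the $Q$-module with the same underlying sup-lattice and action $a\cdot_h x=h(a)x$. For a right $Q$-module $M_1$ and left $Q$-module $M_2$, $M_1\otimes_Q M_2$ is the quotient of the free sup-lattice $\wp(M_1\times M_2)$ by the sup-lattice congruence generated by the pairs $(\{(\bigvee X,y)\},\{(x,y):x\in X\})$, $(\{(x,\bigvee Y)\},\{(x,y):y\in Y\})$, $(\{(xa,y)\},\{(x,ay)\})$; $x\otimes y$ denotes the class of $\{(x,y)\}$. $R\otimes_Q M$ is a $Q$-module via $a\cdot(r\otimes x)=(h(a)r)\otimes x$ (equivalently the restriction along $h$ of its natural left $R$-module structure). -}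

module Defs where

open import Level using (0ℓ)
open import Data.Product using (Σ; _×_; _,_; proj₁; proj₂)
open import Relation.Binary.PropositionalEquality
  using (_≡_; refl; sym; trans; cong; cong₂; subst; module ≡-Reasoning)
open import Relation.Unary using (Pred)

image : {A B : Set} → (A → B) → Pred A 0ℓ → Pred B 0ℓ
image {A} f S b = Σ A λ a → S a × f a ≡ b

record CompleteLattice : Set₁ where
  field
    Carrier   : Set
    _≤_       : Carrier → Carrier → Set
    ≤-refl    : ∀ {x} → x ≤ x
    ≤-trans   : ∀ {x y z} → x ≤ y → y ≤ z → x ≤ z
    ≤-antisym : ∀ {x y} → x ≤ y → y ≤ x → x ≡ y
    ⋁         : Pred Carrier 0ℓ → Carrier
    ⋁-upper   : ∀ S {x} → S x → x ≤ ⋁ S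
    ⋁-least   : ∀ S {u} → (∀ {x} → S x → x ≤ u) → ⋁ S ≤ u

  ⋁-cong : ∀ {S T : Pred Carrier 0ℓ} →
           (∀ {x} → S x → T x) → (∀ {x} → T x → S x) → ⋁ S ≡ ⋁ T
  ⋁-cong {S} {T} st ts =
    ≤-antisym (⋁-least S (λ sx → ⋁-upper T (st sx)))
              (⋁-least T (λ tx → ⋁-upper S (ts tx)))

record Quantale : Set₁ where
  field
    lattice : CompleteLattice
  open CompleteLattice lattice public
  infixl 7 _∙_
  field
    _∙_       : Carrier → Carrier → Carrier
    ε         : Carrier
    assoc     : ∀ a b c → (a ∙ b) ∙ c ≡ a ∙ (b ∙ c)
    identityˡ : ∀ a → ε ∙ a ≡ a
    identityʳ : ∀ a → a ∙ ε ≡ a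
    distribˡ  : ∀ a S → a ∙ ⋁ S ≡ ⋁ (image (a ∙_) S)
    distribʳ  : ∀ S a → ⋁ S ∙ a ≡ ⋁ (image (_∙ a) S)

record QuantaleHom (Q R : Quantale) : Set₁ where
  private
    module Q = Quantale Q
    module R = Quantale R
  field
    fun          : Q.Carrier → R.Carrier
    preserves-⋁  : ∀ S → fun (Q.⋁ S) ≡ R.⋁ (image fun S)
    preserves-∙  : ∀ a b → fun (a Q.∙ b) ≡ fun a R.∙ fun b
    preserves-ε  : fun Q.ε ≡ R.ε

record LeftModule (Q : Quantale) : Set₁ where
  private module Q = Quantale Q
  field
    lattice : CompleteLattice
  open CompleteLattice lattice public
  field
    act         : Q.Carrier → Carrier → Carrier
    act-assoc   : ∀ a b x → act (a Q.∙ b) x ≡ act a (act b x)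
    act-unit    : ∀ x → act Q.ε x ≡ x
    act-distribˡ : ∀ S x → act (Q.⋁ S) x ≡ ⋁ (image (λ a → act a x) S)
    act-distribʳ : ∀ a T → act a (⋁ T) ≡ ⋁ (image (act a) T)

record RightModule (Q : Quantale) : Set₁ where
  private module Q = Quantale Q
  field
    lattice : CompleteLattice
  open CompleteLattice lattice public
  field
    act         : Carrier → Q.Carrier → Carrier
    act-assoc   : ∀ x a b → act (act x a) b ≡ act x (a Q.∙ b)
    act-unit    : ∀ x → act x Q.ε ≡ x
    act-distribˡ : ∀ T a → act (⋁ T) a ≡ ⋁ (image (λ x → act x a) T)
    act-distribʳ : ∀ x S → act x (Q.⋁ S) ≡ ⋁ (image (act x) S)

record LeftModuleHom {Q : Quantale} (M N : LeftModule Q) : Set₁ where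
  private
    module M = LeftModule M
    module N = LeftModule N
  field
    fun           : M.Carrier → N.Carrier
    preserves-⋁   : ∀ S → fun (M.⋁ S) ≡ N.⋁ (image fun S)
    preserves-act : ∀ a x → fun (M.act a x) ≡ N.act a (fun x)

Injective : {A B : Set} → (A → B) → Set
Injective f = ∀ x y → f x ≡ f y → x ≡ y

module _ {Q R : Quantale} (h : QuantaleHom Q R) where
  private
    module Q = Quantale Q
    module R = Quantale R
    module h = QuantaleHom h

  restrictLeft : LeftModule R → LeftModule Q
  restrictLeft N = record
    { lattice      = N.lattice
    ; act          = λ a x → N.act (h.fun a) x
    ; act-assoc    = λ a b x → trans (cong (λ r → N.act r x) (h.preserves-∙ a b))
                                     (N.act-assoc (h.fun a) (h.fun b) x)
    ; act-unit     = λ x → trans (cong (λ r → N.act r x) h.preserves-ε) (N.act-unit x)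
    ; act-distribˡ = λ S x →
        trans (cong (λ r → N.act r x) (h.preserves-⋁ S))
        (trans (N.act-distribˡ (image h.fun S) x)
               (N.⋁-cong (λ { (r , (a , Sa , refl) , refl) → a , Sa , refl })
                         (λ { (a , Sa , refl) → h.fun a , (a , Sa , refl) , refl })))
    ; act-distribʳ = λ a T → N.act-distribʳ (h.fun a) T
    }
    where module N = LeftModule N

  RightVia : RightModule Q
  RightVia = record
    { lattice      = R.lattice
    ; act          = λ r a → r R.∙ h.fun a
    ; act-assoc    = λ r a b → trans (R.assoc r (h.fun a) (h.fun b))
                                     (cong (r R.∙_) (sym (h.preserves-∙ a b)))
    ; act-unit     = λ r → trans (cong (r R.∙_) h.preserves-ε) (R.identityʳ r)
    ; act-distribˡ = λ T a → R.distribʳ T (h.fun a)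
    ; act-distribʳ = λ r S →
        trans (cong (r R.∙_) (h.preserves-⋁ S))
        (trans (R.distribˡ r (image h.fun S))
               (R.⋁-cong (λ { (s , (a , Sa , refl) , refl) → a , Sa , refl })
                         (λ { (a , Sa , refl) → h.fun a , (a , Sa , refl) , refl })))
    }

-- Tensor product M₁ ⊗_Q M₂ as the quotient of the free sup-lattice
-- ℘(M₁ × M₂) by the sup-lattice congruence generated by the three
-- families of pairs.  Since Agda has no quotients we define the
-- generated congruence ~ inductively; x ⊗ y is the class of {(x,y)},
-- so  x ⊗ y = x' ⊗ y'  in the tensor product iff  ⟨x,y⟩ ~ ⟨x',y'⟩.

module Tensor {Q : Quantale} (M₁ : RightModule Q) (M₂ : LeftModule Q) where
  private
    module M₁ = RightModule M₁
    module M₂ = LeftModule M₂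

  Subset : Set₁
  Subset = Pred (M₁.Carrier × M₂.Carrier) 0ℓ

  ⟨_,_⟩ : M₁.Carrier → M₂.Carrier → Subset
  ⟨ x , y ⟩ p = p ≡ (x , y)

  ⋃ : {I : Set} → (I → Subset) → Subset
  ⋃ {I} A p = Σ I λ i → A i p

  data _~_ : Subset → Subset → Set₁ where
    gen-⋁ˡ : ∀ (X : Pred M₁.Carrier 0ℓ) y →
             ⟨ M₁.⋁ X , y ⟩ ~ (λ p → Σ M₁.Carrier λ x → X x × p ≡ (x , y))
    gen-⋁ʳ : ∀ x (Y : Pred M₂.Carrier 0ℓ) →
             ⟨ x , M₂.⋁ Y ⟩ ~ (λ p → Σ M₂.Carrier λ y → Y y × p ≡ (x , y))
    gen-act : ∀ x a y → ⟨ M₁.act x a , y ⟩ ~ ⟨ x , M₂.act a y ⟩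
    -- equivalence relation (reflexivity on extensionally equal subsets,
    -- i.e. on equal elements of ℘(M₁ × M₂))
    ~-refl  : ∀ {A B} → (∀ {p} → A p → B p) → (∀ {p} → B p → A p) → A ~ B
    ~-sym   : ∀ {A B} → A ~ B → B ~ A
    ~-trans : ∀ {A B C} → A ~ B → B ~ C → A ~ C
    ~-⋃     : ∀ {I : Set} (A B : I → Subset) → (∀ i → A i ~ B i) → ⋃ A ~ ⋃ B

-- The tensor product has the universal property of a quotient: any map
-- β : R × M → L into a sup-lattice that is join-preserving in each variable
-- and balanced extends to ℘(R × M) by A ↦ ⋁ β[A], and this extension is
-- constant on classes of the generated congruence.  For
-- β (r , x) = r · f x ∈ N, balancedness is the fact that f is a Q-module
-- map into N_h.  Hence 1 ⊗ x = 1 ⊗ y forces f x = f y, and x = y.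
module Submission where

open import Defs
open import Relation.Binary.PropositionalEquality
  using (_≡_; refl; sym; trans; cong; module ≡-Reasoning)
open import Data.Product using (Σ; _×_; _,_)
open import Relation.Unary using (Pred; _⊆_)
open import Level using (0ℓ)

module _ (L : CompleteLattice) where
  open CompleteLattice L

  ≤-reflexive : ∀ {x y} → x ≡ y → x ≤ y
  ≤-reflexive refl = ≤-refl

  ⋁-image-mono : {A : Set} (g : A → Carrier) {S T : Pred A 0ℓ} →
                 S ⊆ T → ⋁ (image g S) ≤ ⋁ (image g T)
  ⋁-image-mono g {S} {T} S⊆T =
    ⋁-least (image g S) λ { (a , Sa , refl) → ⋁-upper (image g T) (a , S⊆T Sa , refl) }

  ⋁-image-singleton : {A : Set} (g : A → Carrier) (a : A) →
                      ⋁ (image g (λ b → b ≡ a)) ≡ g a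
  ⋁-image-singleton g a = ≤-antisym
    (⋁-least (image g (λ b → b ≡ a)) λ { (_ , refl , refl) → ≤-refl })
    (⋁-upper (image g (λ b → b ≡ a)) (a , refl , refl))

record BalancedMap {Q : Quantale} (M₁ : RightModule Q) (M₂ : LeftModule Q)
                   (L : CompleteLattice) : Set₁ where
  private
    module M₁ = RightModule M₁
    module M₂ = LeftModule M₂
    module L = CompleteLattice L
  field
    fun         : M₁.Carrier → M₂.Carrier → L.Carrier
    preserves-⋁ˡ : ∀ X y → fun (M₁.⋁ X) y ≡ L.⋁ (image (λ x → fun x y) X)
    preserves-⋁ʳ : ∀ x Y → fun x (M₂.⋁ Y) ≡ L.⋁ (image (fun x) Y)
    balanced    : ∀ x a y → fun (M₁.act x a) y ≡ fun x (M₂.act a y)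

module BalancedExtension {Q : Quantale} {M₁ : RightModule Q} {M₂ : LeftModule Q}
                         {L : CompleteLattice} (β : BalancedMap M₁ M₂ L) where
  private
    module M₁ = RightModule M₁
    module M₂ = LeftModule M₂
    module L = CompleteLattice L
    module β = BalancedMap β
  open Tensor M₁ M₂

  uncurried : M₁.Carrier × M₂.Carrier → L.Carrier
  uncurried (x , y) = β.fun x y

  extend : Subset → L.Carrier
  extend A = L.⋁ (image uncurried A)

  extend-⟨⟩ : ∀ x y → extend ⟨ x , y ⟩ ≡ β.fun x y
  extend-⟨⟩ x y = ⋁-image-singleton L uncurried (x , y)

  extend-⋃-mono : {I : Set} (A B : I → Subset) →
                  (∀ i → extend (A i) L.≤ extend (B i)) → extend (⋃ A) L.≤ extend (⋃ B)
  extend-⋃-mono A B A≤B = L.⋁-least (image uncurried (⋃ A)) λ { (p , (i , Aip) , refl) →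
    L.≤-trans (L.⋁-upper (image uncurried (A i)) (p , Aip , refl))
      (L.≤-trans (A≤B i) (⋁-image-mono L uncurried (λ Bip → i , Bip))) }

  extend-resp-~ : ∀ {A B} → A ~ B → extend A ≡ extend B
  extend-resp-~ (gen-⋁ˡ X y) = begin
    extend ⟨ M₁.⋁ X , y ⟩               ≡⟨ extend-⟨⟩ (M₁.⋁ X) y ⟩
    β.fun (M₁.⋁ X) y                    ≡⟨ β.preserves-⋁ˡ X y ⟩
    L.⋁ (image (λ x → β.fun x y) X)     ≡⟨ L.⋁-cong (λ { (x , Xx , refl) → (x , y) , (x , Xx , refl) , refl })
                                                    (λ { (_ , (x , Xx , refl) , refl) → x , Xx , refl }) ⟩
    extend (λ p → Σ _ λ x → X x × p ≡ (x , y)) ∎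
    where open ≡-Reasoning
  extend-resp-~ (gen-⋁ʳ x Y) = begin
    extend ⟨ x , M₂.⋁ Y ⟩               ≡⟨ extend-⟨⟩ x (M₂.⋁ Y) ⟩
    β.fun x (M₂.⋁ Y)                    ≡⟨ β.preserves-⋁ʳ x Y ⟩
    L.⋁ (image (β.fun x) Y)             ≡⟨ L.⋁-cong (λ { (y , Yy , refl) → (x , y) , (y , Yy , refl) , refl })
                                                    (λ { (_ , (y , Yy , refl) , refl) → y , Yy , refl }) ⟩
    extend (λ p → Σ _ λ y → Y y × p ≡ (x , y)) ∎
    where open ≡-Reasoning
  extend-resp-~ (gen-act x a y) = begin
    extend ⟨ M₁.act x a , y ⟩           ≡⟨ extend-⟨⟩ (M₁.act x a) y ⟩
    β.fun (M₁.act x a) y                ≡⟨ β.balanced x a y ⟩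
    β.fun x (M₂.act a y)                ≡⟨ extend-⟨⟩ x (M₂.act a y) ⟨
    extend ⟨ x , M₂.act a y ⟩           ∎
    where open ≡-Reasoning
  extend-resp-~ (~-refl A⊆B B⊆A) =
    L.≤-antisym (⋁-image-mono L uncurried A⊆B) (⋁-image-mono L uncurried B⊆A)
  extend-resp-~ (~-sym A~B) = sym (extend-resp-~ A~B)
  extend-resp-~ (~-trans A~B B~C) = trans (extend-resp-~ A~B) (extend-resp-~ B~C)
  extend-resp-~ (~-⋃ A B A~B) = L.≤-antisym
    (extend-⋃-mono A B λ i → ≤-reflexive L (extend-resp-~ (A~B i)))
    (extend-⋃-mono B A λ i → ≤-reflexive L (sym (extend-resp-~ (A~B i))))

module _ {Q R : Quantale} (h : QuantaleHom Q R) {M : LeftModule Q} {N : LeftModule R} where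
  private
    module R = Quantale R
    module h = QuantaleHom h
    module M = LeftModule M
    module N = LeftModule N

  act∘hom-balanced : LeftModuleHom M (restrictLeft h N) →
                     BalancedMap (RightVia h) M N.lattice
  act∘hom-balanced f = record
    { fun          = λ r x → N.act r (f.fun x)
    ; preserves-⋁ˡ = λ X x → N.act-distribˡ X (f.fun x)
    ; preserves-⋁ʳ = λ r Y → begin
        N.act r (f.fun (M.⋁ Y))                ≡⟨ cong (N.act r) (f.preserves-⋁ Y) ⟩
        N.act r (N.⋁ (image f.fun Y))          ≡⟨ N.act-distribʳ r (image f.fun Y) ⟩
        N.⋁ (image (N.act r) (image f.fun Y))  ≡⟨ N.⋁-cong (λ { (_ , (y , Yy , refl) , refl) → y , Yy , refl })
                                                           (λ { (y , Yy , refl) → f.fun y , (y , Yy , refl) , refl }) ⟩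
        N.⋁ (image (λ y → N.act r (f.fun y)) Y) ∎
    ; balanced     = λ r a x → begin
        N.act (r R.∙ h.fun a) (f.fun x)        ≡⟨ N.act-assoc r (h.fun a) (f.fun x) ⟩
        N.act r (N.act (h.fun a) (f.fun x))    ≡⟨ cong (N.act r) (f.preserves-act a x) ⟨
        N.act r (f.fun (M.act a x))            ∎
    }
    where
      module f = LeftModuleHom f
      open ≡-Reasoning

proposition3p2 : (Q R : Quantale) (h : QuantaleHom Q R) (M : LeftModule Q) →
    Σ (LeftModule R) (λ N → Σ (LeftModuleHom M (restrictLeft h N)) (λ f →
      Injective (LeftModuleHom.fun f))) →
    ∀ x y → Tensor._~_ (RightVia h) M
              (Tensor.⟨_,_⟩ (RightVia h) M (Quantale.ε R) x)
              (Tensor.⟨_,_⟩ (RightVia h) M (Quantale.ε R) y) →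
            x ≡ y
proposition3p2 Q R h M (N , f , f-injective) x y 1⊗x~1⊗y = f-injective x y (begin
  f.fun x                        ≡⟨ N.act-unit (f.fun x) ⟨
  N.act (Quantale.ε R) (f.fun x) ≡⟨ extend-⟨⟩ _ x ⟨
  extend ⟨ Quantale.ε R , x ⟩    ≡⟨ extend-resp-~ 1⊗x~1⊗y ⟩
  extend ⟨ Quantale.ε R , y ⟩    ≡⟨ extend-⟨⟩ _ y ⟩
  N.act (Quantale.ε R) (f.fun y) ≡⟨ N.act-unit (f.fun y) ⟩
  f.fun y                        ∎)
  where
    module N = LeftModule N
    module f = LeftModuleHom f
    open Tensor (RightVia h) M
    open BalancedExtension (act∘hom-balanced h f)
    open ≡-Reasoning
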